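{- Let $F\subseteq E(Q_4)$ with $|F|=2$ and let $M$ be a matching of $Q_4-F$ with $|M|=2$. Then there exists a Hamiltonian cycle of $Q_4-F$ containing $M$.
   Context: $Q_4$ is the 4-dimensional hypercube; $Q_4-F$ is $Q_4$ with the edges of $F$ deleted. A matching is a set of pairwise vertex-disjoint edges. -}

module Defs where

open import Data.Bool using (Bool; true; false; if_then_else_)
open import Data.Nat using (ℕ; zero; suc; _+_)
open import Data.Vec using (Vec; []; _∷_)
open import Data.List using (List; []; _∷_; length)
open import Data.List.Relation.Unary.Unique.Propositional using (Unique)
open import Data.List.Relation.Unary.Any using (Any)
open import Data.Product using (_×_; _,_; Σ; ∃)
open import Data.Sum using (_⊎_)
open import Data.Empty using (⊥)
open import Relation.Binary.PropositionalEquality using (_≡_)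
open import Relation.Nullary using (¬_)

Vertex : ℕ → Set
Vertex n = Vec Bool n

hamming : ∀ {n} → Vec Bool n → Vec Bool n → ℕ
hamming [] [] = 0
hamming (x ∷ xs) (y ∷ ys) = (if x Data.Bool.xor y then 1 else 0) + hamming xs ys
  where import Data.Bool

Adjacent : ∀ {n} → Vertex n → Vertex n → Set
Adjacent u v = hamming u v ≡ 1

-- An edge of Q_n, given by its two endpoints (an unordered pair; see SameEdge).
record Edge (n : ℕ) : Set where
  constructor edge
  field
    end₁ : Vertex n
    end₂ : Vertex n
    adj  : Adjacent end₁ end₂
open Edge public

SameEdge : ∀ {n} → Edge n → Edge n → Set
SameEdge e f = (end₁ e ≡ end₁ f × end₂ e ≡ end₂ f) ⊎ (end₁ e ≡ end₂ f × end₂ e ≡ end₁ f)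

IsEdge : ∀ {n} → Vertex n → Vertex n → Edge n → Set
IsEdge u v e = (u ≡ end₁ e × v ≡ end₂ e) ⊎ (u ≡ end₂ e × v ≡ end₁ e)

Incident : ∀ {n} → Vertex n → Edge n → Set
Incident x e = x ≡ end₁ e ⊎ x ≡ end₂ e

Disjoint : ∀ {n} → Edge n → Edge n → Set
Disjoint e f = ∀ x → Incident x e → Incident x f → ⊥

-- A set of two faulty edges F = {f₁, f₂} (distinct, so |F| = 2).
-- {u,v} is an edge of Q_n − F: adjacent in Q_n and not equal to f₁ or f₂.
EdgeAvoiding : ∀ {n} → Edge n → Edge n → Vertex n → Vertex n → Set
EdgeAvoiding f₁ f₂ u v =
  Adjacent u v × ¬ IsEdge u v f₁ × ¬ IsEdge u v f₂

cyclicPairsAux : ∀ {A : Set} → A → List A → List (A × A)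
cyclicPairsAux x₀ [] = []
cyclicPairsAux x₀ (x ∷ []) = (x , x₀) ∷ []
cyclicPairsAux x₀ (x ∷ y ∷ xs) = (x , y) ∷ cyclicPairsAux x₀ (y ∷ xs)

cyclicPairs : ∀ {A : Set} → List A → List (A × A)
cyclicPairs [] = []
cyclicPairs (x ∷ xs) = cyclicPairsAux x (x ∷ xs)

open import Data.List.Relation.Unary.All using (All)

-- A Hamiltonian cycle of Q_n − {f₁,f₂}, given as the cyclic sequence of
-- its vertices: 2^n pairwise distinct vertices (hence every vertex exactly
-- once), cyclically consecutive ones joined by edges of Q_n − {f₁,f₂}.
-- (For n ≥ 2, 2^n ≥ 3 so this is a genuine cycle.)
record HamCycle (n : ℕ) (f₁ f₂ : Edge n) : Set where
  constructor hamCycle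
  field
    verts    : List (Vertex n)
    distinct : Unique verts
    spanning : length verts ≡ 2 Data.Nat.^ n
    edges    : All (λ p → EdgeAvoiding f₁ f₂ (Data.Product.proj₁ p) (Data.Product.proj₂ p))
                   (cyclicPairs verts)
open HamCycle public

UsesEdge : ∀ {n f₁ f₂} → HamCycle n f₁ f₂ → Edge n → Set
UsesEdge C e = Any (λ p → IsEdge (Data.Product.proj₁ p) (Data.Product.proj₂ p) e) (cyclicPairs (verts C))

-- Translations u ↦ c ⊕ u and transpositions of adjacent coordinates are
-- involutive isometries of Q_n; they carry the hypotheses and any solution along, and together
-- they move every edge onto the edge {0, e₀}. So it suffices to treat the first faulty edge
-- {0, e₀}. In Q₄ the remaining configurations (second faulty edge, two disjoint matching edges)
-- are finitely many, and each is covered by one of 44 explicit Hamiltonian cycles of Q₄.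

module Submission where

open import Defs
open import Level using (Level)
open import Algebra.Properties.CommutativeSemigroup using (x∙yz≈y∙xz)
open import Data.Bool using (Bool; true; false; _∧_; _xor_; T; if_then_else_)
open import Data.Bool.ListAction using (all; any)
open import Data.Bool.Properties using (T?; T-∧; not-involutive; xor-same; xor-annihilates-not)
  renaming (_≟_ to _≟ᵇ_)
open import Data.Empty using (⊥; ⊥-elim)
open import Data.Fin using (toℕ)
open import Data.List using (List; []; _∷_; [_]; _++_; map; length; filter; upTo; zipWith)
open import Data.List.Membership.Propositional using (_∈_; find)
open import Data.List.Membership.Propositional.Properties using (∈-++⁺ˡ; ∈-++⁺ʳ; ∈-map⁺; ∈-filter⁻)
open import Data.List.Properties using (length-map; map-∘; map-cong; map-id)
open import Data.List.Relation.Unary.All as All using (All)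
open import Data.List.Relation.Unary.All.Properties using (all⁺; ¬Any⇒All¬) renaming (map⁺ to All-map⁺)
open import Data.List.Relation.Unary.AllPairs using (AllPairs; []; _∷_)
open import Data.List.Relation.Unary.Any as Any using (Any; here; there)
open import Data.List.Relation.Unary.Any.Properties using (any⁻) renaming (map⁺ to Any-map⁺)
import Data.List.Relation.Unary.Unique.DecPropositional as UniqueDec
open import Data.List.Relation.Unary.Unique.Propositional using (Unique)
import Data.List.Relation.Unary.Unique.Propositional.Properties as Unique
open import Data.Nat using (ℕ; zero; suc; _+_; _<_; _^_; _%_; _/_; _≡ᵇ_; z≤n; s≤s)
open import Data.Nat.Properties using (suc-injective; <⇒≤; +-commutativeSemigroup)
  renaming (_≟_ to _≟ⁿ_)
open import Data.Product using (Σ; ∃-syntax; _×_; _,_; proj₁; proj₂; uncurry)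
import Data.Product as Product
open import Data.Sum using (_⊎_; inj₁; inj₂)
open import Data.Vec using (Vec; []; _∷_; replicate; tabulate)
import Data.Vec as Vec
open import Data.Vec.Properties using (≡-dec)
open import Function using (_∘_; case_of_)
open import Function.Bundles using (Equivalence)
open import Relation.Binary using (DecidableEquality)
open import Relation.Binary.PropositionalEquality using (_≡_; _≢_; refl; sym; trans; cong; cong₂; subst; subst₂)
open import Relation.Nullary using (¬_; Dec; yes; no; ¬?; _×-dec_; _⊎-dec_; _→-dec_)
open import Relation.Nullary.Decidable using (⌊_⌋; toWitness)

private
  variable
    a : Level
    A B : Set a
    n : ℕ

-- Unordered pairs

infix 4 _≐_ _∈ₚ_

_≐_ : A × A → A × A → Set _
(u , v) ≐ (x , y) = (u ≡ x × v ≡ y) ⊎ (u ≡ y × v ≡ x)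

≐-reflexive : {p q : A × A} → p ≡ q → p ≐ q
≐-reflexive refl = inj₁ (refl , refl)

≐-sym : {p q : A × A} → p ≐ q → q ≐ p
≐-sym (inj₁ (refl , refl)) = inj₁ (refl , refl)
≐-sym (inj₂ (refl , refl)) = inj₂ (refl , refl)

≐-trans : {p q r : A × A} → p ≐ q → q ≐ r → p ≐ r
≐-trans (inj₁ (refl , refl)) q≐r = q≐r
≐-trans (inj₂ (refl , refl)) (inj₁ (refl , refl)) = inj₂ (refl , refl)
≐-trans (inj₂ (refl , refl)) (inj₂ (refl , refl)) = inj₁ (refl , refl)

≐-map : (f : A → B) {p q : A × A} → p ≐ q → Product.map f f p ≐ Product.map f f q
≐-map f (inj₁ (refl , refl)) = inj₁ (refl , refl)
≐-map f (inj₂ (refl , refl)) = inj₂ (refl , refl)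

≐-dec : DecidableEquality A → (p q : A × A) → Dec (p ≐ q)
≐-dec _≟_ (u , v) (x , y) = ((u ≟ x) ×-dec (v ≟ y)) ⊎-dec ((u ≟ y) ×-dec (v ≟ x))

_∈ₚ_ : A → A × A → Set _
x ∈ₚ (u , v) = x ≡ u ⊎ x ≡ v

∈ₚ-resp-≐ : {x : A} {p q : A × A} → p ≐ q → x ∈ₚ p → x ∈ₚ q
∈ₚ-resp-≐ (inj₁ (refl , refl)) x∈p = x∈p
∈ₚ-resp-≐ (inj₂ (refl , refl)) (inj₁ x≡u) = inj₂ x≡u
∈ₚ-resp-≐ (inj₂ (refl , refl)) (inj₂ x≡v) = inj₁ x≡v

∈ₚ-map : (f : A → B) {x : A} {p : A × A} → x ∈ₚ p → f x ∈ₚ Product.map f f p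
∈ₚ-map f (inj₁ refl) = inj₁ refl
∈ₚ-map f (inj₂ refl) = inj₂ refl

Apart : A × A → A × A → Set _
Apart p q = ∀ x → x ∈ₚ p → x ∈ₚ q → ⊥

Apart-sym : {p q : A × A} → Apart p q → Apart q p
Apart-sym p∩q=∅ x x∈q x∈p = p∩q=∅ x x∈p x∈q

Apart-irrefl : {p : A × A} → ¬ Apart p p
Apart-irrefl p∩p=∅ = p∩p=∅ _ (inj₁ refl) (inj₁ refl)

Apart-resp-≐ : {p p′ q q′ : A × A} → p ≐ p′ → q ≐ q′ → Apart p q → Apart p′ q′
Apart-resp-≐ p≐p′ q≐q′ p∩q=∅ x x∈p′ x∈q′ =
  p∩q=∅ x (∈ₚ-resp-≐ (≐-sym p≐p′) x∈p′) (∈ₚ-resp-≐ (≐-sym q≐q′) x∈q′)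

Apart-map⁻ : (f : A → B) {p q : A × A} → Apart (Product.map f f p) (Product.map f f q) → Apart p q
Apart-map⁻ f fp∩fq=∅ x x∈p x∈q = fp∩fq=∅ (f x) (∈ₚ-map f x∈p) (∈ₚ-map f x∈q)

apart? : DecidableEquality A → (p q : A × A) → Dec (Apart p q)
apart? _≟_ (u , v) (x , y) with u ≟ x | u ≟ y | v ≟ x | v ≟ y
... | yes u≡x | _ | _ | _ = no λ p∩q=∅ → p∩q=∅ u (inj₁ refl) (inj₁ u≡x)
... | no _ | yes u≡y | _ | _ = no λ p∩q=∅ → p∩q=∅ u (inj₁ refl) (inj₂ u≡y)
... | no _ | no _ | yes v≡x | _ = no λ p∩q=∅ → p∩q=∅ v (inj₂ refl) (inj₁ v≡x)
... | no _ | no _ | no _ | yes v≡y = no λ p∩q=∅ → p∩q=∅ v (inj₂ refl) (inj₂ v≡y)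
... | no u≢x | no u≢y | no v≢x | no v≢y = yes apart
  where
  apart : Apart (u , v) (x , y)
  apart _ (inj₁ refl) (inj₁ refl) = u≢x refl
  apart _ (inj₁ refl) (inj₂ refl) = u≢y refl
  apart _ (inj₂ refl) (inj₁ refl) = v≢x refl
  apart _ (inj₂ refl) (inj₂ refl) = v≢y refl

AllPairs-lookup : {R : A → A → Set} {xs : List A} {x y : A} →
                  AllPairs R xs → x ∈ xs → y ∈ xs → x ≢ y → R x y ⊎ R y x
AllPairs-lookup (_ ∷ _) (here refl) (here refl) x≢y = ⊥-elim (x≢y refl)
AllPairs-lookup (Rx ∷ _) (here refl) (there y∈xs) _ = inj₁ (All.lookup Rx y∈xs)
AllPairs-lookup (Rx ∷ _) (there x∈xs) (here refl) _ = inj₂ (All.lookup Rx x∈xs)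
AllPairs-lookup (_ ∷ Rxs) (there x∈xs) (there y∈xs) x≢y = AllPairs-lookup Rxs x∈xs y∈xs x≢y

cyclicPairsAux-map : (f : A → B) (x₀ : A) (xs : List A) →
                     cyclicPairsAux (f x₀) (map f xs) ≡ map (Product.map f f) (cyclicPairsAux x₀ xs)
cyclicPairsAux-map f x₀ [] = refl
cyclicPairsAux-map f x₀ (x ∷ []) = refl
cyclicPairsAux-map f x₀ (x ∷ y ∷ xs) = cong ((f x , f y) ∷_) (cyclicPairsAux-map f x₀ (y ∷ xs))

cyclicPairs-map : (f : A → B) (xs : List A) → cyclicPairs (map f xs) ≡ map (Product.map f f) (cyclicPairs xs)
cyclicPairs-map f [] = refl
cyclicPairs-map f (x ∷ xs) = cyclicPairsAux-map f x (x ∷ xs)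

-- Hamiltonian cycles in faulty hypercubes

ends : Edge n → Vertex n × Vertex n
ends e = end₁ e , end₂ e

_≟ᵛ_ : DecidableEquality (Vertex n)
_≟ᵛ_ = ≡-dec _≟ᵇ_

origin : Vertex n
origin = replicate _ false

unit : ℕ → Vertex n
unit {zero} _ = []
unit {suc n} zero = true ∷ origin
unit {suc n} (suc d) = false ∷ unit d

hamming≡0⇒≡ : (u v : Vertex n) → hamming u v ≡ 0 → u ≡ v
hamming≡0⇒≡ [] [] _ = refl
hamming≡0⇒≡ (false ∷ u) (false ∷ v) h = cong (false ∷_) (hamming≡0⇒≡ u v h)
hamming≡0⇒≡ (true ∷ u) (true ∷ v) h = cong (true ∷_) (hamming≡0⇒≡ u v h)

origin-neighbour : (w : Vertex n) → Adjacent origin w → ∃[ d ] d < n × w ≡ unit d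
origin-neighbour (true ∷ w) h = 0 , s≤s z≤n , cong (true ∷_) (sym (hamming≡0⇒≡ origin w (suc-injective h)))
origin-neighbour (false ∷ w) h with origin-neighbour w h
... | d , d<n , w≡unit = suc d , s≤s d<n , cong (false ∷_) w≡unit

Traverses : List (Vertex n) → Vertex n × Vertex n → Set
Traverses vs p = Any (_≐ p) (cyclicPairs vs)

Traverses-resp-≐ : (vs : List (Vertex n)) {p q : Vertex n × Vertex n} → p ≐ q → Traverses vs p → Traverses vs q
Traverses-resp-≐ _ p≐q = Any.map (λ r≐p → ≐-trans r≐p p≐q)

Traverses-map : (f : Vertex n → Vertex n) {vs : List (Vertex n)} {p : Vertex n × Vertex n} →
                Traverses vs p → Traverses (map f vs) (Product.map f f p)
Traverses-map f {vs} t rewrite cyclicPairs-map f vs = Any-map⁺ (Any.map (≐-map f) t)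

IsHamiltonian : List (Vertex n) → Set
IsHamiltonian {n} vs = Unique vs × length vs ≡ 2 ^ n × All (uncurry Adjacent) (cyclicPairs vs)

vertices : ∀ n → List (Vertex n)
vertices zero = [ [] ]
vertices (suc n) = map (false ∷_) (vertices n) ++ map (true ∷_) (vertices n)

∈-vertices : (u : Vertex n) → u ∈ vertices n
∈-vertices [] = here refl
∈-vertices (false ∷ u) = ∈-++⁺ˡ (∈-map⁺ (false ∷_) (∈-vertices u))
∈-vertices {suc n} (true ∷ u) = ∈-++⁺ʳ (map (false ∷_) (vertices n)) (∈-map⁺ (true ∷_) (∈-vertices u))

traverses? : (vs : List (Vertex n)) (p : Vertex n × Vertex n) → Dec (Traverses vs p)
traverses? vs p = Any.any? (λ q → ≐-dec _≟ᵛ_ q p) (cyclicPairs vs)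

isHamiltonian? : (vs : List (Vertex n)) → Dec (IsHamiltonian vs)
isHamiltonian? {n} vs =
  unique? vs ×-dec length vs ≟ⁿ 2 ^ n ×-dec All.all? (λ (u , v) → hamming u v ≟ⁿ 1) (cyclicPairs vs)
  where open UniqueDec (_≟ᵛ_ {n}) using (unique?)

record Extension (φ₁ φ₂ μ₁ μ₂ : Vertex n × Vertex n) : Set where
  constructor extension
  field
    tour : List (Vertex n)
    hamiltonian : IsHamiltonian tour
    avoids₁ : ¬ Traverses tour φ₁
    avoids₂ : ¬ Traverses tour φ₂
    uses₁ : Traverses tour μ₁
    uses₂ : Traverses tour μ₂

Extension-swap : {φ₁ φ₂ μ₁ μ₂ : Vertex n × Vertex n} → Extension φ₁ φ₂ μ₁ μ₂ → Extension φ₁ φ₂ μ₂ μ₁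
Extension-swap (extension t h a₁ a₂ u₁ u₂) = extension t h a₁ a₂ u₂ u₁

toHamCycle : {f₁ f₂ m₁ m₂ : Edge n} → Extension (ends f₁) (ends f₂) (ends m₁) (ends m₂) →
             Σ (HamCycle n f₁ f₂) (λ C → UsesEdge C m₁ × UsesEdge C m₂)
toHamCycle (extension t (unique , size , adjacent) ¬f₁ ¬f₂ m₁ m₂) =
  hamCycle t unique size (All.zip (adjacent , All.zip (¬Any⇒All¬ _ ¬f₁ , ¬Any⇒All¬ _ ¬f₂))) , m₁ , m₂

record Admissible (φ₁ φ₂ μ₁ μ₂ : Vertex n × Vertex n) : Set where
  field
    φ₂-edge : uncurry Adjacent φ₂
    μ₁-edge : uncurry Adjacent μ₁
    μ₂-edge : uncurry Adjacent μ₂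
    μ₁≉φ₁ : ¬ μ₁ ≐ φ₁
    μ₁≉φ₂ : ¬ μ₁ ≐ φ₂
    μ₂≉φ₁ : ¬ μ₂ ≐ φ₁
    μ₂≉φ₂ : ¬ μ₂ ≐ φ₂
    μ₁∩μ₂=∅ : Apart μ₁ μ₂

ExtensibleAt : Vertex n × Vertex n → Set
ExtensibleAt φ₁ = ∀ {φ₂ μ₁ μ₂} → Admissible φ₁ φ₂ μ₁ μ₂ → Extension φ₁ φ₂ μ₁ μ₂

-- Symmetries of the hypercube

record Involution (n : ℕ) : Set where
  field
    act : Vertex n → Vertex n
    involutive : ∀ u → act (act u) ≡ u
    isometry : ∀ u v → hamming (act u) (act v) ≡ hamming u v

module _ (σ : Involution n) where
  open Involution σ

  act₂ : Vertex n × Vertex n → Vertex n × Vertex n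
  act₂ = Product.map act act

  act₂-involutive : ∀ p → act₂ (act₂ p) ≡ p
  act₂-involutive (u , v) = cong₂ _,_ (involutive u) (involutive v)

  act-injective : ∀ {u v} → act u ≡ act v → u ≡ v
  act-injective {u} {v} eq = trans (sym (involutive u)) (trans (cong act eq) (involutive v))

  map-act-involutive : ∀ vs → map act (map act vs) ≡ vs
  map-act-involutive vs = trans (sym (map-∘ vs)) (trans (map-cong involutive vs) (map-id vs))

  ≐-act⁻ : ∀ {p q} → act₂ p ≐ act₂ q → p ≐ q
  ≐-act⁻ {p} {q} = subst₂ _≐_ (act₂-involutive p) (act₂-involutive q) ∘ ≐-map act

  IsHamiltonian-act : ∀ {vs} → IsHamiltonian vs → IsHamiltonian (map act vs)
  IsHamiltonian-act {vs} (unique , size , adjacent) =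
    Unique.map⁺ act-injective unique ,
    trans (length-map act vs) size ,
    subst (All (uncurry Adjacent)) (sym (cyclicPairs-map act vs))
      (All-map⁺ (All.map (λ {p} adj → trans (isometry (proj₁ p) (proj₂ p)) adj) adjacent))

  Admissible-act : ∀ {φ₁ φ₂ μ₁ μ₂} → Admissible φ₁ φ₂ μ₁ μ₂ →
                   Admissible (act₂ φ₁) (act₂ φ₂) (act₂ μ₁) (act₂ μ₂)
  Admissible-act {μ₁ = μ₁} {μ₂} adm = record
    { φ₂-edge = adjacent φ₂-edge
    ; μ₁-edge = adjacent μ₁-edge
    ; μ₂-edge = adjacent μ₂-edge
    ; μ₁≉φ₁ = μ₁≉φ₁ ∘ ≐-act⁻
    ; μ₁≉φ₂ = μ₁≉φ₂ ∘ ≐-act⁻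
    ; μ₂≉φ₁ = μ₂≉φ₁ ∘ ≐-act⁻
    ; μ₂≉φ₂ = μ₂≉φ₂ ∘ ≐-act⁻
    ; μ₁∩μ₂=∅ = Apart-map⁻ act (subst₂ Apart (sym (act₂-involutive μ₁)) (sym (act₂-involutive μ₂)) μ₁∩μ₂=∅)
    }
    where
    open Admissible adm
    adjacent : ∀ {p} → uncurry Adjacent p → uncurry Adjacent (act₂ p)
    adjacent {u , v} adj = trans (isometry u v) adj

  Extension-act⁻ : ∀ {φ₁ φ₂ μ₁ μ₂} → Extension (act₂ φ₁) (act₂ φ₂) (act₂ μ₁) (act₂ μ₂) → Extension φ₁ φ₂ μ₁ μ₂
  Extension-act⁻ (extension t ham ¬φ₁ ¬φ₂ μ₁ μ₂) =
    extension (map act t) (IsHamiltonian-act ham) (¬φ₁ ∘ pull) (¬φ₂ ∘ pull) (push μ₁) (push μ₂)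
    where
    pull : ∀ {p} → Traverses (map act t) p → Traverses t (act₂ p)
    pull = subst (λ vs → Traverses vs _) (map-act-involutive t) ∘ Traverses-map act {map act t}
    push : ∀ {p} → Traverses t (act₂ p) → Traverses (map act t) p
    push {p} = subst (Traverses (map act t)) (act₂-involutive p) ∘ Traverses-map act {t}

  extensibleAt-act⁻ : ∀ {φ} → ExtensibleAt (act₂ φ) → ExtensibleAt φ
  extensibleAt-act⁻ extensible = Extension-act⁻ ∘ extensible ∘ Admissible-act

_⊕_ : Vertex n → Vertex n → Vertex n
_⊕_ = Vec.zipWith _xor_

⊕-involutive : (c u : Vertex n) → c ⊕ (c ⊕ u) ≡ u
⊕-involutive [] [] = refl
⊕-involutive (false ∷ c) (x ∷ u) = cong (x ∷_) (⊕-involutive c u)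
⊕-involutive (true ∷ c) (x ∷ u) = cong₂ _∷_ (not-involutive x) (⊕-involutive c u)

⊕-self : (u : Vertex n) → u ⊕ u ≡ origin
⊕-self [] = refl
⊕-self (x ∷ u) = cong₂ _∷_ (xor-same x) (⊕-self u)

hamming-⊕ : (c u v : Vertex n) → hamming (c ⊕ u) (c ⊕ v) ≡ hamming u v
hamming-⊕ [] [] [] = refl
hamming-⊕ (false ∷ c) (x ∷ u) (y ∷ v) = cong (_ +_) (hamming-⊕ c u v)
hamming-⊕ (true ∷ c) (x ∷ u) (y ∷ v) =
  cong₂ (λ b h → (if b then 1 else 0) + h) (xor-annihilates-not x y) (hamming-⊕ c u v)

translation : Vertex n → Involution n
translation c = record { act = c ⊕_ ; involutive = ⊕-involutive c ; isometry = hamming-⊕ c }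

-- Exchanges coordinates d and d + 1 (the identity when d + 1 ≥ n).
transpose : ℕ → Vertex n → Vertex n
transpose zero (x ∷ y ∷ u) = y ∷ x ∷ u
transpose (suc d) (x ∷ u) = x ∷ transpose d u
transpose _ u = u

transpose-involutive : (d : ℕ) (u : Vertex n) → transpose d (transpose d u) ≡ u
transpose-involutive zero [] = refl
transpose-involutive zero (x ∷ []) = refl
transpose-involutive zero (x ∷ y ∷ u) = refl
transpose-involutive (suc d) [] = refl
transpose-involutive (suc d) (x ∷ u) = cong (x ∷_) (transpose-involutive d u)

hamming-transpose : (d : ℕ) (u v : Vertex n) → hamming (transpose d u) (transpose d v) ≡ hamming u v
hamming-transpose zero [] [] = refl
hamming-transpose zero (x ∷ []) (x′ ∷ []) = refl
hamming-transpose zero (x ∷ y ∷ u) (x′ ∷ y′ ∷ v) =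
  x∙yz≈y∙xz +-commutativeSemigroup (δ y y′) (δ x x′) (hamming u v)
  where
  δ : Bool → Bool → ℕ
  δ b b′ = if b xor b′ then 1 else 0
hamming-transpose (suc d) [] [] = refl
hamming-transpose (suc d) (x ∷ u) (x′ ∷ v) = cong (_ +_) (hamming-transpose d u v)

transposition : ℕ → Involution n
transposition d = record
  { act = transpose d ; involutive = transpose-involutive d ; isometry = hamming-transpose d }

transpose-origin : (d : ℕ) → transpose d (origin {n}) ≡ origin
transpose-origin {zero} zero = refl
transpose-origin {suc zero} zero = refl
transpose-origin {suc (suc n)} zero = refl
transpose-origin {zero} (suc d) = refl
transpose-origin {suc n} (suc d) = cong (false ∷_) (transpose-origin d)

transpose-unit : (d : ℕ) → suc d < n → transpose d (unit {n} (suc d)) ≡ unit d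
transpose-unit {suc (suc n)} zero _ = refl
transpose-unit {suc n} (suc d) (s≤s d+1<n) = cong (false ∷_) (transpose-unit d d+1<n)
transpose-unit {suc zero} zero (s≤s ())

extensibleAtUnit : ExtensibleAt {n} (origin , unit 0) → (d : ℕ) → d < n → ExtensibleAt (origin , unit d)
extensibleAtUnit extensible zero _ = extensible
extensibleAtUnit extensible (suc d) d+1<n =
  extensibleAt-act⁻ (transposition d)
    (subst ExtensibleAt (cong₂ _,_ (sym (transpose-origin d)) (sym (transpose-unit d d+1<n)))
      (extensibleAtUnit extensible d (<⇒≤ d+1<n)))

extensibleAtEdge : ExtensibleAt {n} (origin , unit 0) → ∀ {φ} → uncurry Adjacent φ → ExtensibleAt φ
extensibleAtEdge extensible {a , b} ab =
  extensibleAt-act⁻ (translation a)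
    (subst ExtensibleAt (cong₂ _,_ (sym (⊕-self a)) (sym a⊕b≡unit)) (extensibleAtUnit extensible d d<n))
  where
  origin-adjacent : Adjacent origin (a ⊕ b)
  origin-adjacent = subst (λ o → Adjacent o (a ⊕ b)) (⊕-self a) (trans (hamming-⊕ a a b) ab)
  d = proj₁ (origin-neighbour (a ⊕ b) origin-adjacent)
  d<n = proj₁ (proj₂ (origin-neighbour (a ⊕ b) origin-adjacent))
  a⊕b≡unit = proj₂ (proj₂ (origin-neighbour (a ⊕ b) origin-adjacent))

-- Q₄ with the faulty edge {0, e₀}, by a finite certificate

bit : ℕ → ℕ → Bool
bit m zero = m % 2 ≡ᵇ 1
bit m (suc i) = bit (m / 2) i

-- Vertices are coded by numbers through their binary digits, least significant first.
vertexOf : ℕ → Vertex n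
vertexOf m = tabulate (bit m ∘ toℕ)

record CodedEdge : Set where
  constructor codedEdge
  field
    index : ℕ
    codes : ℕ × ℕ
open CodedEdge

endsᶜ : CodedEdge → Vertex 4 × Vertex 4
endsᶜ e = Product.map vertexOf vertexOf (codes e)

edgeList : List CodedEdge
edgeList = zipWith codedEdge (upTo 32)
  ( (0 , 1) ∷ (0 , 2) ∷ (0 , 4) ∷ (0 , 8)
  ∷ (1 , 3) ∷ (1 , 5) ∷ (1 , 9)
  ∷ (2 , 3) ∷ (2 , 6) ∷ (2 , 10)
  ∷ (3 , 7) ∷ (3 , 11)
  ∷ (4 , 5) ∷ (4 , 6) ∷ (4 , 12)
  ∷ (5 , 7) ∷ (5 , 13)
  ∷ (6 , 7) ∷ (6 , 14)
  ∷ (7 , 15)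
  ∷ (8 , 9) ∷ (8 , 10) ∷ (8 , 12)
  ∷ (9 , 11) ∷ (9 , 13)
  ∷ (10 , 11) ∷ (10 , 14)
  ∷ (11 , 15)
  ∷ (12 , 13) ∷ (12 , 14)
  ∷ (13 , 15)
  ∷ (14 , 15)
  ∷ [])

edge₀ : CodedEdge
edge₀ = codedEdge 0 (0 , 1)

Listed : Vertex 4 × Vertex 4 → Set
Listed p = Any (λ e → p ≐ endsᶜ e) edgeList

everyEdgeListed? : Dec (All (λ u → All (λ v → Adjacent u v → Listed (u , v)) (vertices 4)) (vertices 4))
everyEdgeListed? = All.all? (λ u → All.all? (λ v →
  hamming u v ≟ⁿ 1 →-dec Any.any? (λ e → ≐-dec _≟ᵛ_ (u , v) (endsᶜ e)) edgeList) (vertices 4)) (vertices 4)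

opaque
  everyEdgeListed : All (λ u → All (λ v → Adjacent u v → Listed (u , v)) (vertices 4)) (vertices 4)
  everyEdgeListed = toWitness {a? = everyEdgeListed?} _

locate : ∀ {p} → uncurry Adjacent p → ∃[ e ] e ∈ edgeList × p ≐ endsᶜ e
locate {u , v} adj = find (All.lookup (All.lookup everyEdgeListed (∈-vertices u)) (∈-vertices v) adj)

-- A tour given by vertex codes, with its edge set as a bit mask over the positions in edgeList.
record Certificate : Set where
  constructor certificate
  field
    mask : ℕ
    tour : List ℕ
open Certificate

tourVertices : Certificate → List (Vertex 4)
tourVertices c = map vertexOf (tour c)

Uses : Certificate → CodedEdge → Set
Uses c e = T (bit (mask c) (index e))

uses? : ∀ c e → Dec (Uses c e)
uses? c e = T? (bit (mask c) (index e))

Exact : Certificate → CodedEdge → Set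
Exact c e = (Uses c e → Traverses (tourVertices c) (endsᶜ e)) × (Traverses (tourVertices c) (endsᶜ e) → Uses c e)

exact? : ∀ c e → Dec (Exact c e)
exact? c e = (uses? c e →-dec traverses? (tourVertices c) (endsᶜ e)) ×-dec (traverses? (tourVertices c) (endsᶜ e) →-dec uses? c e)

Valid : Certificate → Set
Valid c = IsHamiltonian (tourVertices c) × All (Exact c) edgeList

valid? : ∀ c → Dec (Valid c)
valid? c = isHamiltonian? (tourVertices c) ×-dec All.all? (exact? c) edgeList

certificates : List Certificate
certificates =
  certificate 1034563770 (0 ∷ 2 ∷ 3 ∷ 1 ∷ 5 ∷ 4 ∷ 6 ∷ 7 ∷ 15 ∷ 11 ∷ 9 ∷ 13 ∷ 12 ∷ 14 ∷ 10 ∷ 8 ∷ [])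
  ∷ certificate 3260501606 (0 ∷ 2 ∷ 10 ∷ 11 ∷ 3 ∷ 7 ∷ 6 ∷ 14 ∷ 15 ∷ 13 ∷ 5 ∷ 1 ∷ 9 ∷ 8 ∷ 12 ∷ 4 ∷ [])
  ∷ certificate 505266652 (0 ∷ 4 ∷ 12 ∷ 13 ∷ 5 ∷ 7 ∷ 15 ∷ 11 ∷ 10 ∷ 14 ∷ 6 ∷ 2 ∷ 3 ∷ 1 ∷ 9 ∷ 8 ∷ [])
  ∷ certificate 3785542460 (0 ∷ 4 ∷ 12 ∷ 14 ∷ 15 ∷ 13 ∷ 9 ∷ 11 ∷ 3 ∷ 1 ∷ 5 ∷ 7 ∷ 6 ∷ 2 ∷ 10 ∷ 8 ∷ [])
  ∷ certificate 1799665242 (0 ∷ 2 ∷ 10 ∷ 11 ∷ 15 ∷ 13 ∷ 9 ∷ 1 ∷ 3 ∷ 7 ∷ 5 ∷ 4 ∷ 6 ∷ 14 ∷ 12 ∷ 8 ∷ [])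
  ∷ certificate 2496212844 (0 ∷ 4 ∷ 6 ∷ 2 ∷ 10 ∷ 14 ∷ 15 ∷ 7 ∷ 3 ∷ 11 ∷ 9 ∷ 1 ∷ 5 ∷ 13 ∷ 12 ∷ 8 ∷ [])
  ∷ certificate 2083659110 (0 ∷ 2 ∷ 6 ∷ 7 ∷ 3 ∷ 11 ∷ 15 ∷ 13 ∷ 12 ∷ 14 ∷ 10 ∷ 8 ∷ 9 ∷ 1 ∷ 5 ∷ 4 ∷ [])
  ∷ certificate 2465046742 (0 ∷ 2 ∷ 3 ∷ 1 ∷ 9 ∷ 11 ∷ 10 ∷ 8 ∷ 12 ∷ 13 ∷ 5 ∷ 7 ∷ 15 ∷ 14 ∷ 6 ∷ 4 ∷ [])
  ∷ certificate 1196316906 (0 ∷ 2 ∷ 3 ∷ 11 ∷ 10 ∷ 14 ∷ 6 ∷ 7 ∷ 15 ∷ 13 ∷ 9 ∷ 1 ∷ 5 ∷ 4 ∷ 12 ∷ 8 ∷ [])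
  ∷ certificate 2870175290 (0 ∷ 2 ∷ 10 ∷ 11 ∷ 15 ∷ 14 ∷ 12 ∷ 4 ∷ 6 ∷ 7 ∷ 3 ∷ 1 ∷ 5 ∷ 13 ∷ 9 ∷ 8 ∷ [])
  ∷ certificate 1922832188 (0 ∷ 4 ∷ 5 ∷ 1 ∷ 3 ∷ 7 ∷ 15 ∷ 13 ∷ 12 ∷ 14 ∷ 6 ∷ 2 ∷ 10 ∷ 11 ∷ 9 ∷ 8 ∷ [])
  ∷ certificate 1290256598 (0 ∷ 2 ∷ 3 ∷ 1 ∷ 9 ∷ 11 ∷ 15 ∷ 13 ∷ 5 ∷ 7 ∷ 6 ∷ 14 ∷ 10 ∷ 8 ∷ 12 ∷ 4 ∷ [])
  ∷ certificate 2741705046 (0 ∷ 2 ∷ 6 ∷ 7 ∷ 15 ∷ 14 ∷ 12 ∷ 8 ∷ 10 ∷ 11 ∷ 3 ∷ 1 ∷ 9 ∷ 13 ∷ 5 ∷ 4 ∷ [])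
  ∷ certificate 2636180842 (0 ∷ 2 ∷ 6 ∷ 4 ∷ 12 ∷ 13 ∷ 9 ∷ 1 ∷ 5 ∷ 7 ∷ 3 ∷ 11 ∷ 15 ∷ 14 ∷ 10 ∷ 8 ∷ [])
  ∷ certificate 943565398 (0 ∷ 2 ∷ 10 ∷ 8 ∷ 9 ∷ 1 ∷ 3 ∷ 11 ∷ 15 ∷ 7 ∷ 5 ∷ 13 ∷ 12 ∷ 14 ∷ 6 ∷ 4 ∷ [])
  ∷ certificate 1866507756 (0 ∷ 4 ∷ 6 ∷ 2 ∷ 3 ∷ 7 ∷ 5 ∷ 1 ∷ 9 ∷ 13 ∷ 15 ∷ 11 ∷ 10 ∷ 14 ∷ 12 ∷ 8 ∷ [])
  ∷ certificate 2581993014 (0 ∷ 2 ∷ 10 ∷ 8 ∷ 12 ∷ 13 ∷ 9 ∷ 11 ∷ 15 ∷ 14 ∷ 6 ∷ 7 ∷ 3 ∷ 1 ∷ 5 ∷ 4 ∷ [])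
  ∷ certificate 3599950010 (0 ∷ 2 ∷ 3 ∷ 1 ∷ 5 ∷ 7 ∷ 6 ∷ 4 ∷ 12 ∷ 13 ∷ 15 ∷ 14 ∷ 10 ∷ 11 ∷ 9 ∷ 8 ∷ [])
  ∷ certificate 1655522796 (0 ∷ 4 ∷ 12 ∷ 14 ∷ 6 ∷ 2 ∷ 3 ∷ 7 ∷ 15 ∷ 13 ∷ 5 ∷ 1 ∷ 9 ∷ 11 ∷ 10 ∷ 8 ∷ [])
  ∷ certificate 3334690138 (0 ∷ 2 ∷ 6 ∷ 7 ∷ 3 ∷ 1 ∷ 9 ∷ 11 ∷ 10 ∷ 14 ∷ 15 ∷ 13 ∷ 5 ∷ 4 ∷ 12 ∷ 8 ∷ [])
  ∷ certificate 1692084790 (0 ∷ 2 ∷ 10 ∷ 14 ∷ 12 ∷ 8 ∷ 9 ∷ 11 ∷ 3 ∷ 1 ∷ 5 ∷ 13 ∷ 15 ∷ 7 ∷ 6 ∷ 4 ∷ [])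
  ∷ certificate 2605093596 (0 ∷ 4 ∷ 5 ∷ 7 ∷ 6 ∷ 14 ∷ 15 ∷ 11 ∷ 10 ∷ 2 ∷ 3 ∷ 1 ∷ 9 ∷ 13 ∷ 12 ∷ 8 ∷ [])
  ∷ certificate 488528442 (0 ∷ 2 ∷ 10 ∷ 14 ∷ 6 ∷ 7 ∷ 15 ∷ 11 ∷ 3 ∷ 1 ∷ 5 ∷ 4 ∷ 12 ∷ 13 ∷ 9 ∷ 8 ∷ [])
  ∷ certificate 1197263158 (0 ∷ 2 ∷ 6 ∷ 14 ∷ 10 ∷ 11 ∷ 3 ∷ 1 ∷ 5 ∷ 7 ∷ 15 ∷ 13 ∷ 9 ∷ 8 ∷ 12 ∷ 4 ∷ [])
  ∷ certificate 3121817324 (0 ∷ 4 ∷ 6 ∷ 7 ∷ 3 ∷ 2 ∷ 10 ∷ 11 ∷ 15 ∷ 14 ∷ 12 ∷ 13 ∷ 5 ∷ 1 ∷ 9 ∷ 8 ∷ [])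
  ∷ certificate 1713068378 (0 ∷ 2 ∷ 6 ∷ 7 ∷ 15 ∷ 13 ∷ 5 ∷ 4 ∷ 12 ∷ 14 ∷ 10 ∷ 11 ∷ 3 ∷ 1 ∷ 9 ∷ 8 ∷ [])
  ∷ certificate 725565622 (0 ∷ 2 ∷ 3 ∷ 1 ∷ 5 ∷ 13 ∷ 9 ∷ 8 ∷ 10 ∷ 11 ∷ 15 ∷ 7 ∷ 6 ∷ 14 ∷ 12 ∷ 4 ∷ [])
  ∷ certificate 3097696092 (0 ∷ 4 ∷ 5 ∷ 13 ∷ 12 ∷ 14 ∷ 15 ∷ 11 ∷ 9 ∷ 1 ∷ 3 ∷ 7 ∷ 6 ∷ 2 ∷ 10 ∷ 8 ∷ [])
  ∷ certificate 481125610 (0 ∷ 2 ∷ 3 ∷ 7 ∷ 15 ∷ 11 ∷ 9 ∷ 1 ∷ 5 ∷ 13 ∷ 12 ∷ 4 ∷ 6 ∷ 14 ∷ 10 ∷ 8 ∷ [])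
  ∷ certificate 1422793452 (0 ∷ 4 ∷ 5 ∷ 1 ∷ 9 ∷ 11 ∷ 3 ∷ 2 ∷ 10 ∷ 14 ∷ 6 ∷ 7 ∷ 15 ∷ 13 ∷ 12 ∷ 8 ∷ [])
  ∷ certificate 3005758826 (0 ∷ 2 ∷ 6 ∷ 4 ∷ 5 ∷ 1 ∷ 9 ∷ 13 ∷ 12 ∷ 14 ∷ 15 ∷ 7 ∷ 3 ∷ 11 ∷ 10 ∷ 8 ∷ [])
  ∷ certificate 3524579180 (0 ∷ 4 ∷ 12 ∷ 13 ∷ 15 ∷ 14 ∷ 6 ∷ 2 ∷ 10 ∷ 11 ∷ 3 ∷ 7 ∷ 5 ∷ 1 ∷ 9 ∷ 8 ∷ [])
  ∷ certificate 1034461628 (0 ∷ 4 ∷ 6 ∷ 2 ∷ 3 ∷ 1 ∷ 5 ∷ 7 ∷ 15 ∷ 11 ∷ 9 ∷ 13 ∷ 12 ∷ 14 ∷ 10 ∷ 8 ∷ [])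
  ∷ certificate 2750095542 (0 ∷ 2 ∷ 3 ∷ 1 ∷ 5 ∷ 13 ∷ 9 ∷ 11 ∷ 10 ∷ 8 ∷ 12 ∷ 14 ∷ 15 ∷ 7 ∷ 6 ∷ 4 ∷ [])
  ∷ certificate 2370038362 (0 ∷ 2 ∷ 10 ∷ 14 ∷ 15 ∷ 11 ∷ 3 ∷ 1 ∷ 9 ∷ 13 ∷ 5 ∷ 7 ∷ 6 ∷ 4 ∷ 12 ∷ 8 ∷ [])
  ∷ certificate 3567446250 (0 ∷ 2 ∷ 3 ∷ 11 ∷ 9 ∷ 1 ∷ 5 ∷ 7 ∷ 6 ∷ 4 ∷ 12 ∷ 13 ∷ 15 ∷ 14 ∷ 10 ∷ 8 ∷ [])
  ∷ certificate 2380481846 (0 ∷ 2 ∷ 6 ∷ 7 ∷ 3 ∷ 1 ∷ 5 ∷ 13 ∷ 9 ∷ 11 ∷ 15 ∷ 14 ∷ 10 ∷ 8 ∷ 12 ∷ 4 ∷ [])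
  ∷ certificate 977211606 (0 ∷ 2 ∷ 3 ∷ 1 ∷ 9 ∷ 8 ∷ 10 ∷ 11 ∷ 15 ∷ 7 ∷ 6 ∷ 14 ∷ 12 ∷ 13 ∷ 5 ∷ 4 ∷ [])
  ∷ certificate 1456255194 (0 ∷ 2 ∷ 3 ∷ 1 ∷ 9 ∷ 11 ∷ 10 ∷ 14 ∷ 6 ∷ 4 ∷ 5 ∷ 7 ∷ 15 ∷ 13 ∷ 12 ∷ 8 ∷ [])
  ∷ certificate 977085670 (0 ∷ 2 ∷ 3 ∷ 7 ∷ 15 ∷ 11 ∷ 10 ∷ 8 ∷ 9 ∷ 1 ∷ 5 ∷ 13 ∷ 12 ∷ 14 ∷ 6 ∷ 4 ∷ [])
  ∷ certificate 3123909974 (0 ∷ 2 ∷ 6 ∷ 7 ∷ 3 ∷ 1 ∷ 9 ∷ 8 ∷ 10 ∷ 11 ∷ 15 ∷ 14 ∷ 12 ∷ 13 ∷ 5 ∷ 4 ∷ [])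
  ∷ certificate 2493213242 (0 ∷ 2 ∷ 10 ∷ 14 ∷ 15 ∷ 7 ∷ 6 ∷ 4 ∷ 12 ∷ 13 ∷ 5 ∷ 1 ∷ 3 ∷ 11 ∷ 9 ∷ 8 ∷ [])
  ∷ certificate 1555480758 (0 ∷ 2 ∷ 3 ∷ 1 ∷ 5 ∷ 7 ∷ 6 ∷ 14 ∷ 10 ∷ 8 ∷ 9 ∷ 11 ∷ 15 ∷ 13 ∷ 12 ∷ 4 ∷ [])
  ∷ certificate 2573512294 (0 ∷ 2 ∷ 10 ∷ 8 ∷ 12 ∷ 13 ∷ 9 ∷ 1 ∷ 5 ∷ 7 ∷ 3 ∷ 11 ∷ 15 ∷ 14 ∷ 6 ∷ 4 ∷ [])
  ∷ []

opaque
  certificatesValid : All Valid certificates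
  certificatesValid = toWitness {a? = All.all? valid? certificates} _

avoiding : CodedEdge → List Certificate
avoiding f = filter (λ c → ¬? (uses? c edge₀) ×-dec ¬? (uses? c f)) certificates

users : CodedEdge → List Certificate → List Certificate
users g = filter (λ c → uses? c g)

Clear : CodedEdge → CodedEdge → Set
Clear f g = ¬ codes g ≐ codes edge₀ × ¬ codes g ≐ codes f

Matchable : CodedEdge → CodedEdge → CodedEdge → Set
Matchable f g₁ g₂ = Clear f g₁ × Clear f g₂ × Apart (codes g₁) (codes g₂)

matchable? : ∀ f g₁ g₂ → Dec (Matchable f g₁ g₂)
matchable? f g₁ g₂ = clear? g₁ ×-dec clear? g₂ ×-dec apart? _≟ⁿ_ (codes g₁) (codes g₂)
  where
  clear? : ∀ g → Dec (Clear f g)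
  clear? g = ¬? (≐-dec _≟ⁿ_ (codes g) (codes edge₀)) ×-dec ¬? (≐-dec _≟ⁿ_ (codes g) (codes f))

Covered : CodedEdge → CodedEdge → CodedEdge → Set
Covered f g₁ g₂ = Matchable f g₁ g₂ → Any (λ c → Uses c g₂) (users g₁ (avoiding f))

coveredᵇ : CodedEdge → CodedEdge → List Certificate → CodedEdge → Bool
coveredᵇ f g₁ cs g₂ = if ⌊ matchable? f g₁ g₂ ⌋ then any (λ c → bit (mask c) (index g₂)) cs else true

-- users g₁ (avoiding f) is passed as an argument so that it is computed once for all g₂.
coversᵇ : CodedEdge → List CodedEdge → Bool
coversᵇ f [] = true
coversᵇ f (g₁ ∷ gs) = all (coveredᵇ f g₁ (users g₁ (avoiding f))) gs ∧ coversᵇ f gs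

coveredᵇ-sound : ∀ {f g₁ g₂} → T (coveredᵇ f g₁ (users g₁ (avoiding f)) g₂) → Covered f g₁ g₂
coveredᵇ-sound {f} {g₁} {g₂} ok matchable with matchable? f g₁ g₂
... | yes _ = any⁻ _ (users g₁ (avoiding f)) ok
... | no ¬matchable = ⊥-elim (¬matchable matchable)

coversᵇ-sound : ∀ f gs → T (coversᵇ f gs) → AllPairs (Covered f) gs
coversᵇ-sound f [] _ = []
coversᵇ-sound f (g₁ ∷ gs) ok with Equivalence.to T-∧ ok
... | first , rest = All.map (λ {g₂} → coveredᵇ-sound {f} {g₁} {g₂}) (all⁺ _ gs first) ∷ coversᵇ-sound f gs rest

opaque
  everyMatchingCovered : All (λ f → AllPairs (Covered f) edgeList) edgeList
  everyMatchingCovered = All.map (λ {f} → coversᵇ-sound f edgeList) (all⁺ (λ f → coversᵇ f edgeList) edgeList _)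

clear : ∀ {μ φ} g f → μ ≐ endsᶜ g → φ ≐ endsᶜ f → ¬ μ ≐ φ → ¬ codes g ≐ codes f
clear _ _ μ≐g φ≐f μ≉φ g≐f = μ≉φ (≐-trans μ≐g (≐-trans (≐-map vertexOf g≐f) (≐-sym φ≐f)))

Apart-codes⇒≢ : ∀ {g₁ g₂} → Apart (codes g₁) (codes g₂) → g₁ ≢ g₂
Apart-codes⇒≢ g₁∩g₂=∅ refl = Apart-irrefl g₁∩g₂=∅

certified : ∀ {f g₁ g₂} → Any (λ c → Uses c g₂) (users g₁ (avoiding f)) →
            ∃[ c ] Valid c × ¬ Uses c edge₀ × ¬ Uses c f × Uses c g₁ × Uses c g₂
certified {f} {g₁} {g₂} covered with find covered
... | c , c∈users , uses₂ with ∈-filter⁻ (λ c → uses? c g₁) c∈users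
... | c∈avoiding , uses₁ with ∈-filter⁻ (λ c → ¬? (uses? c edge₀) ×-dec ¬? (uses? c f)) c∈avoiding
... | c∈certificates , ¬uses₀ , ¬uses-f =
  c , All.lookup certificatesValid c∈certificates , ¬uses₀ , ¬uses-f , uses₁ , uses₂

extensionOf : ∀ {φ₂ μ₁ μ₂ f g₁ g₂} → f ∈ edgeList → g₁ ∈ edgeList → g₂ ∈ edgeList →
              φ₂ ≐ endsᶜ f → μ₁ ≐ endsᶜ g₁ → μ₂ ≐ endsᶜ g₂ →
              Any (λ c → Uses c g₂) (users g₁ (avoiding f)) → Extension (origin , unit 0) φ₂ μ₁ μ₂
extensionOf {f = f} {g₁} {g₂} f∈ g₁∈ g₂∈ φ₂≐f μ₁≐g₁ μ₂≐g₂ covered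
  with certified {f} {g₁} {g₂} covered
... | c , (hamiltonian , exact) , ¬uses₀ , ¬uses-f , uses₁ , uses₂ =
  extension t hamiltonian
    (¬uses₀ ∘ complete (here refl)) (¬uses-f ∘ complete f∈ ∘ Traverses-resp-≐ t φ₂≐f)
    (Traverses-resp-≐ t (≐-sym μ₁≐g₁) (sound g₁∈ uses₁)) (Traverses-resp-≐ t (≐-sym μ₂≐g₂) (sound g₂∈ uses₂))
  where
  t = tourVertices c
  sound : ∀ {e} → e ∈ edgeList → Uses c e → Traverses t (endsᶜ e)
  sound e∈ = proj₁ (All.lookup exact e∈)
  complete : ∀ {e} → e ∈ edgeList → Traverses t (endsᶜ e) → Uses c e
  complete e∈ = proj₂ (All.lookup exact e∈)

extensibleAtUnit₀ : ExtensibleAt {4} (origin , unit 0)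
extensibleAtUnit₀ adm =
  let open Admissible adm
      f , f∈ , φ₂≐f = locate φ₂-edge
      g₁ , g₁∈ , μ₁≐g₁ = locate μ₁-edge
      g₂ , g₂∈ , μ₂≐g₂ = locate μ₂-edge
      codes-apart = Apart-map⁻ vertexOf (Apart-resp-≐ μ₁≐g₁ μ₂≐g₂ μ₁∩μ₂=∅)
      clear₁ = clear g₁ edge₀ μ₁≐g₁ (≐-reflexive refl) μ₁≉φ₁ , clear g₁ f μ₁≐g₁ φ₂≐f μ₁≉φ₂
      clear₂ = clear g₂ edge₀ μ₂≐g₂ (≐-reflexive refl) μ₂≉φ₁ , clear g₂ f μ₂≐g₂ φ₂≐f μ₂≉φ₂
  in case AllPairs-lookup (All.lookup everyMatchingCovered f∈) g₁∈ g₂∈ (Apart-codes⇒≢ codes-apart) of λ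
     { (inj₁ covered) → extensionOf f∈ g₁∈ g₂∈ φ₂≐f μ₁≐g₁ μ₂≐g₂ (covered (clear₁ , clear₂ , codes-apart))
     ; (inj₂ covered) → Extension-swap
         (extensionOf f∈ g₂∈ g₁∈ φ₂≐f μ₂≐g₂ μ₁≐g₁ (covered (clear₂ , clear₁ , Apart-sym codes-apart)))
     }

lemma4p6 : (f₁ f₂ : Edge 4) → ¬ SameEdge f₁ f₂ →
           (m₁ m₂ : Edge 4) →
           ¬ SameEdge m₁ f₁ → ¬ SameEdge m₁ f₂ →
           ¬ SameEdge m₂ f₁ → ¬ SameEdge m₂ f₂ →
           Disjoint m₁ m₂ →
           Σ (HamCycle 4 f₁ f₂) (λ C → UsesEdge C m₁ × UsesEdge C m₂)
-- The faulty edges need not be distinct.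
lemma4p6 f₁ f₂ _ m₁ m₂ m₁≉f₁ m₁≉f₂ m₂≉f₁ m₂≉f₂ m₁∩m₂=∅ =
  toHamCycle {f₁ = f₁} {f₂} {m₁} {m₂} (extensibleAtEdge extensibleAtUnit₀ (adj f₁) record
    { φ₂-edge = adj f₂ ; μ₁-edge = adj m₁ ; μ₂-edge = adj m₂
    ; μ₁≉φ₁ = m₁≉f₁ ; μ₁≉φ₂ = m₁≉f₂ ; μ₂≉φ₁ = m₂≉f₁ ; μ₂≉φ₂ = m₂≉f₂
    ; μ₁∩μ₂=∅ = m₁∩m₂=∅
    })
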